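{- $\mathcal{P}^{(1)}_{\mathbf{c}}(1)=2$, $\mathcal{P}^{(1)}_{\mathbf{c}}(2)=2$, and for every $n\geq 1$, \[\mathcal{P}^{(1)}_{\mathbf{c}}(3n)=2\mathcal{P}^{(1)}_{\mathbf{c}}(n)-1,\qquad \mathcal{P}^{(1)}_{\mathbf{c}}(3n+1)=\mathcal{P}^{(1)}_{\mathbf{c}}(3n+2)=\mathcal{P}^{(1)}_{\mathbf{c}}(n)+\mathcal{P}^{(1)}_{\mathbf{c}}(n+1)-1.\] Moreover, $(\mathcal{P}^{(1)}_{\mathbf{c}}(n))_{n\geq 1}$ is a $3$-regular sequence.
   Context: The Cantor sequence $\mathbf{c}=c_0c_1c_2\cdots\in\{0,1\}^{\mathbb N}$ is defined by $c_0=1$ and $c_{3n}=c_{3n+2}=c_n$, $c_{3n+1}=0$ for all $n\geq 0$. A factor of $\mathbf c$ of length $n$ is a word $c_ic_{i+1}\cdots c_{i+n-1}$. The abelian complexity $\mathcal P^{(1)}_{\mathbf c}(n)$ is the number of equivalence classes of factors of length $n$ of $\mathbf c$ under the relation: two words are equivalent if each letter occurs the same number of times in both. An integer sequence $(w_n)$ is $3$-regular if the $\mathbb Z$-module generated by its $3$-kernel $\{(w_{3^en+r})_{n}\mid e\geq0,\ 0\le r<3^e\}$ is finitely generated. -}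

module Defs where

open import Data.Nat using (ℕ; zero; suc; _+_; _*_; _^_; _<_; _/_; _%_)
open import Data.Fin using (Fin) renaming (_≟_ to _≟ᶠ_)
open import Data.Integer using (ℤ) renaming (_+_ to _+ℤ_; _*_ to _*ℤ_)
open import Data.List using (List; []; _∷_; map; upTo; length; filter; zipWith; foldr)
open import Data.List.Relation.Unary.All using (All)
open import Data.List.Relation.Unary.Unique.Propositional using (Unique)
open import Data.List.Membership.Propositional using (_∈_)
open import Data.Product using (Σ; ∃; _×_; _,_)
open import Function.Bundles using (_⇔_)
open import Relation.Binary.PropositionalEquality using (_≡_)

-- The Cantor sequence  c_0 = 1, c_{3n} = c_{3n+2} = c_n, c_{3n+1} = 0.
-- Implemented by recursion with a fuel argument (fuel ≥ argument
-- suffices, since n / 3 < n for n ≥ 1).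

cantorF : ℕ → ℕ → Fin 2
cantorF zero    _       = Fin.suc Fin.zero
cantorF (suc f) zero    = Fin.suc Fin.zero
cantorF (suc f) (suc m) with suc m % 3
... | 1 = Fin.zero
... | _ = cantorF f (suc m / 3)

cantor : ℕ → Fin 2
cantor n = cantorF n n

factor : ℕ → ℕ → List (Fin 2)
factor i n = map (λ j → cantor (i + j)) (upTo n)

parikh : List (Fin 2) → ℕ × ℕ
parikh w = length (filter (_≟ᶠ Fin.zero) w) , length (filter (_≟ᶠ Fin.suc Fin.zero) w)

-- v is the Parikh vector of some factor of length n of c
-- (abelian equivalence classes of factors ↔ Parikh vectors realised)
IsFactorParikh : ℕ → ℕ × ℕ → Set
IsFactorParikh n v = ∃ λ i → parikh (factor i n) ≡ v

HasCard : (ℕ × ℕ → Set) → ℕ → Set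
HasCard P k = Σ (List (ℕ × ℕ)) λ xs → length xs ≡ k × Unique xs × (∀ v → (v ∈ xs) ⇔ P v)

AbelianComplexity : ℕ → ℕ → Set
AbelianComplexity n k = HasCard (IsFactorParikh n) k

LinComb : List (ℕ → ℤ) → (ℕ → ℤ) → Set
LinComb gs f = Σ (List ℤ) λ cs → length cs ≡ length gs ×
  (∀ n → f n ≡ foldr _+ℤ_ (ℤ.pos 0) (zipWith (λ a g → a *ℤ g n) cs gs))

InSpan : ((ℕ → ℤ) → Set) → (ℕ → ℤ) → Set
InSpan S f = Σ (List (ℕ → ℤ)) λ gs → All S gs × LinComb gs f

InKernel : ℕ → (ℕ → ℤ) → (ℕ → ℤ) → Set
InKernel k w f = Σ ℕ λ e → Σ ℕ λ r → r < k ^ e × (∀ n → f n ≡ w (k ^ e * n + r))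

Regular : ℕ → (ℕ → ℤ) → Set
Regular k w = Σ (List (ℕ → ℤ)) λ gs →
  All (InSpan (InKernel k w)) gs × (∀ f → InKernel k w f → LinComb gs f)

-- Write S(n) for the number of 1s in the prefix c_0 ⋯ c_(n-1) of the Cantor
-- sequence and ones(i, n) for the number of 1s in the factor of length n at
-- position i.  The proof rests on three facts.
--  * Recurrences: S(3q) = 2S(q) and S(3q+1) = S(3q+2) = S(q) + S(q+1),
--    from c(3q) = c(3q+2) = c(q), c(3q+1) = 0.
--  * Subadditivity: S(i + n) ≤ S(i) + S(n), i.e. ones(i, n) ≤ S(n).  By
--    strong induction on n: writing i = 3a + r and n = 3b + s, both sides
--    split into prefix counts at about a third of the arguments, bounded by
--    the cases b and b + 1.  For r = s = 2 a pair inequality is needed; it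
--    follows from the cases b, b + 1 because c has no factor 11.
--  * Intermediate values: ones(i, n) drops by at most one when i grows by
--    one, and the middle third c_(3^n) ⋯ c_(2·3^n - 1) is all 0s; hence every
--    count 0, …, S(n) occurs.
-- So the Parikh vectors of length-n factors are (n - j, j), 0 ≤ j ≤ S(n), and
-- P(n) = S(n) + 1; the recurrences for P follow from those for S.  For
-- regularity, S(3^e n + r) = α S(n) + β S(n+1) whenever r ≤ 3^e, so every
-- kernel sequence is an integer combination of three fixed ones.
module Submission where

open import Defs
open import Data.Nat using (ℕ; zero; suc; _+_; _*_; _∸_; _^_; _≤_; _<_; z≤n; s≤s; _/_; _%_)
open import Data.Nat.Properties
open import Data.Nat.DivMod using ([m+kn]%n≡m%n; m<n⇒m%n≡m; m<n⇒m/n≡0; m*n/n≡m; m/n<m; +-distrib-/-∣ʳ)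
open import Data.Nat.Divisibility using (divides)
open import Data.Nat.Induction using (<-rec)
open import Data.Nat.Tactic.RingSolver using (solve-∀; solve)
open import Data.Fin using (Fin; toℕ) renaming (zero to 0F; suc to 1+F)
open import Data.Fin.Properties using (toℕ<n)
open import Data.Product using (Σ; ∃; _×_; _,_; proj₁; proj₂)
open import Data.Sum using (_⊎_; inj₁; inj₂)
open import Data.List using (List; []; _∷_; length; applyUpTo)
open import Data.List.Properties using (length-applyUpTo; map-applyUpTo)
open import Data.List.Membership.Propositional using (_∈_)
open import Data.List.Membership.Propositional.Properties using (∈-applyUpTo⁺; ∈-applyUpTo⁻)
open import Data.List.Relation.Unary.Unique.Propositional using (Unique)
open import Data.List.Relation.Unary.Unique.Propositional.Properties using (applyUpTo⁺₁)
open import Function.Bundles using (mk⇔)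
open import Relation.Binary.PropositionalEquality
open import Relation.Nullary using (yes; no; contradiction)
open import Function using (_∘_; id)
open import Data.Integer using (ℤ; 0ℤ; 1ℤ) renaming (_+_ to _+ℤ_; _*_ to _*ℤ_; _-_ to _-ℤ_)
import Data.Integer.Properties as ℤₚ
open import Data.Integer.Tactic.RingSolver using () renaming (solve-∀ to ℤ-solve-∀)
import Data.List.Relation.Unary.All as All
open import Algebra.Properties.CommutativeSemigroup +-commutativeSemigroup using (interchange)

c : ℕ → ℕ
c n = toℕ (cantor n)

c≤1 : ∀ n → c n ≤ 1
c≤1 n = ≤-pred (toℕ<n (cantor n))

third-smaller : ∀ m → suc m / 3 ≤ m
third-smaller m = ≤-pred (m/n<m (suc m) 3 (s≤s (s≤s z≤n)))

cantorF-fuel : ∀ f g m → m ≤ f → m ≤ g → cantorF f m ≡ cantorF g m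
cantorF-fuel zero    zero    zero    _ _ = refl
cantorF-fuel zero    (suc g) zero    _ _ = refl
cantorF-fuel (suc f) zero    zero    _ _ = refl
cantorF-fuel (suc f) (suc g) zero    _ _ = refl
cantorF-fuel (suc f) (suc g) (suc m) (s≤s m≤f) (s≤s m≤g) with suc m % 3
... | 0           = cantorF-fuel f g (suc m / 3) (≤-trans (third-smaller m) m≤f) (≤-trans (third-smaller m) m≤g)
... | 1           = refl
... | suc (suc _) = cantorF-fuel f g (suc m / 3) (≤-trans (third-smaller m) m≤f) (≤-trans (third-smaller m) m≤g)

cantor-last-digit-1 : ∀ N → N % 3 ≡ 1 → cantor N ≡ 0F
cantor-last-digit-1 (suc m) N%3≡1 with suc m % 3
cantor-last-digit-1 (suc m) refl | .1 = refl

cantor-last-digit-other : ∀ N → N % 3 ≢ 1 → cantor N ≡ cantor (N / 3)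
cantor-last-digit-other zero    _ = refl
cantor-last-digit-other (suc m) N%3≢1 with suc m % 3
... | 0           = cantorF-fuel m (suc m / 3) (suc m / 3) (third-smaller m) ≤-refl
... | 1           = contradiction refl N%3≢1
... | suc (suc _) = cantorF-fuel m (suc m / 3) (suc m / 3) (third-smaller m) ≤-refl

3q+r≡r+q*3 : ∀ q r → 3 * q + r ≡ r + q * 3
3q+r≡r+q*3 q r = trans (+-comm (3 * q) r) (cong (r +_) (*-comm 3 q))

mod-3 : ∀ q r → r < 3 → (3 * q + r) % 3 ≡ r
mod-3 q r r<3 = begin
  (3 * q + r) % 3 ≡⟨ cong (_% 3) (3q+r≡r+q*3 q r) ⟩
  (r + q * 3) % 3 ≡⟨ [m+kn]%n≡m%n r q 3 ⟩
  r % 3           ≡⟨ m<n⇒m%n≡m r<3 ⟩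
  r               ∎
  where open ≡-Reasoning

div-3 : ∀ q r → r < 3 → (3 * q + r) / 3 ≡ q
div-3 q r r<3 = begin
  (3 * q + r) / 3     ≡⟨ cong (_/ 3) (3q+r≡r+q*3 q r) ⟩
  (r + q * 3) / 3     ≡⟨ +-distrib-/-∣ʳ r (divides q refl) ⟩
  r / 3 + q * 3 / 3   ≡⟨ cong₂ _+_ (m<n⇒m/n≡0 r<3) (m*n/n≡m q 3) ⟩
  q                   ∎
  where open ≡-Reasoning

c-digit-kept : ∀ q r → r < 3 → r ≢ 1 → c (3 * q + r) ≡ c q
c-digit-kept q r r<3 r≢1 = cong toℕ (begin
  cantor (3 * q + r)          ≡⟨ cantor-last-digit-other (3 * q + r) (r≢1 ∘ trans (sym (mod-3 q r r<3))) ⟩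
  cantor ((3 * q + r) / 3)    ≡⟨ cong cantor (div-3 q r r<3) ⟩
  cantor q                    ∎)
  where open ≡-Reasoning

c-digit0 : ∀ q → c (3 * q + 0) ≡ c q
c-digit0 q = c-digit-kept q 0 (s≤s z≤n) (λ ())

c-digit1 : ∀ q → c (3 * q + 1) ≡ 0
c-digit1 q = cong toℕ (cantor-last-digit-1 (3 * q + 1) (mod-3 q 1 (s≤s (s≤s z≤n))))

c-digit2 : ∀ q → c (3 * q + 2) ≡ c q
c-digit2 q = c-digit-kept q 2 (s≤s (s≤s (s≤s z≤n))) (λ ())

data Ternary : ℕ → Set where
  digit0 : ∀ q → Ternary (3 * q + 0)
  digit1 : ∀ q → Ternary (3 * q + 1)
  digit2 : ∀ q → Ternary (3 * q + 2)

carry : ∀ q → 3 * suc q + 0 ≡ suc (3 * q + 2)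
carry = solve-∀

ternary : ∀ n → Ternary n
ternary zero = digit0 0
ternary (suc n) with ternary n
... | digit0 q = subst Ternary (+-suc (3 * q) 0) (digit1 q)
... | digit1 q = subst Ternary (+-suc (3 * q) 1) (digit2 q)
... | digit2 q = subst Ternary (carry q) (digit0 (suc q))

ones : ℕ → ℕ → ℕ
ones i zero    = 0
ones i (suc n) = c i + ones (suc i) n

S : ℕ → ℕ
S = ones 0

ones-split : ∀ i m n → ones i (m + n) ≡ ones i m + ones (i + m) n
ones-split i zero    n = cong (λ k → ones k n) (sym (+-identityʳ i))
ones-split i (suc m) n = begin
  c i + ones (suc i) (m + n)                      ≡⟨ cong (c i +_) (ones-split (suc i) m n) ⟩
  c i + (ones (suc i) m + ones (suc i + m) n)     ≡⟨ sym (+-assoc (c i) _ _) ⟩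
  c i + ones (suc i) m + ones (suc i + m) n       ≡⟨ cong (λ k → c i + ones (suc i) m + ones k n) (sym (+-suc i m)) ⟩
  c i + ones (suc i) m + ones (i + suc m) n       ∎
  where open ≡-Reasoning

S-split : ∀ i n → S (i + n) ≡ S i + ones i n
S-split = ones-split 0

ones-snoc : ∀ i n → ones i (suc n) ≡ ones i n + c (i + n)
ones-snoc i n = begin
  ones i (suc n)                 ≡⟨ cong (ones i) (+-comm 1 n) ⟩
  ones i (n + 1)                 ≡⟨ ones-split i n 1 ⟩
  ones i n + (c (i + n) + 0)     ≡⟨ cong (ones i n +_) (+-identityʳ _) ⟩
  ones i n + c (i + n)           ∎
  where open ≡-Reasoning

S-suc : ∀ n → S (suc n) ≡ S n + c n
S-suc = ones-snoc 0

S-flat : ∀ n → c n ≡ 0 → S (suc n) ≡ S n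
S-flat n c[n]≡0 = trans (S-suc n) (trans (cong (S n +_) c[n]≡0) (+-identityʳ (S n)))

ones-mono : ∀ i {m n} → m ≤ n → ones i m ≤ ones i n
ones-mono i {m} {n} m≤n = ≤-trans (m≤m+n (ones i m) (ones (i + m) (n ∸ m)))
  (≤-reflexive (trans (sym (ones-split i m (n ∸ m))) (cong (ones i) (m+[n∸m]≡n m≤n))))

S-mono : ∀ {m n} → m ≤ n → S m ≤ S n
S-mono = ones-mono 0

S-digit0 : ∀ q → S (3 * q + 0) ≡ S q + S q
S-digit1 : ∀ q → S (3 * q + 1) ≡ S q + S (suc q)
S-digit2 : ∀ q → S (3 * q + 2) ≡ S q + S (suc q)

S-digit0 zero    = refl
S-digit0 (suc q) = begin
  S (3 * suc q + 0)             ≡⟨ cong S (carry q) ⟩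
  S (suc (3 * q + 2))           ≡⟨ S-suc (3 * q + 2) ⟩
  S (3 * q + 2) + c (3 * q + 2) ≡⟨ cong₂ _+_ (S-digit2 q) (c-digit2 q) ⟩
  S q + S (suc q) + c q         ≡⟨ cong (_+ c q) (+-comm (S q) (S (suc q))) ⟩
  S (suc q) + S q + c q         ≡⟨ +-assoc (S (suc q)) (S q) (c q) ⟩
  S (suc q) + (S q + c q)       ≡⟨ cong (S (suc q) +_) (sym (S-suc q)) ⟩
  S (suc q) + S (suc q)         ∎
  where open ≡-Reasoning

S-digit1 q = begin
  S (3 * q + 1)                 ≡⟨ cong S (+-suc (3 * q) 0) ⟩
  S (suc (3 * q + 0))           ≡⟨ S-suc (3 * q + 0) ⟩
  S (3 * q + 0) + c (3 * q + 0) ≡⟨ cong₂ _+_ (S-digit0 q) (c-digit0 q) ⟩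
  S q + S q + c q               ≡⟨ +-assoc (S q) (S q) (c q) ⟩
  S q + (S q + c q)             ≡⟨ cong (S q +_) (sym (S-suc q)) ⟩
  S q + S (suc q)               ∎
  where open ≡-Reasoning

S-digit2 q = begin
  S (3 * q + 2)                 ≡⟨ cong S (+-suc (3 * q) 1) ⟩
  S (suc (3 * q + 1))           ≡⟨ S-suc (3 * q + 1) ⟩
  S (3 * q + 1) + c (3 * q + 1) ≡⟨ cong₂ _+_ (S-digit1 q) (c-digit1 q) ⟩
  S q + S (suc q) + 0           ≡⟨ +-identityʳ _ ⟩
  S q + S (suc q)               ∎
  where open ≡-Reasoning

quotient<₂ : ∀ q → suc q < 3 * q + 2
quotient<₂ q = ≤-trans (m≤m+n (2 + q) (2 * q)) (≤-reflexive (solve (q ∷ [])))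

quotient<₀₁ : ∀ q r → suc (suc q) < 3 * suc q + r
quotient<₀₁ q r = ≤-trans (m≤m+n (3 + q) (2 * q + r)) (≤-reflexive (solve (q ∷ r ∷ [])))

no-adjacent-ones : ∀ i → c i ≡ 0 ⊎ c (suc i) ≡ 0
no-adjacent-ones = <-rec _ step
  where
  step : ∀ i → (∀ {j} → j < i → c j ≡ 0 ⊎ c (suc j) ≡ 0) → c i ≡ 0 ⊎ c (suc i) ≡ 0
  step i ih with ternary i
  ... | digit0 q = inj₂ (trans (cong c (sym (+-suc (3 * q) 0))) (c-digit1 q))
  ... | digit1 q = inj₁ (c-digit1 q)
  ... | digit2 q with ih (<-trans (n<1+n q) (quotient<₂ q))
  ...   | inj₁ c[q]≡0   = inj₁ (trans (c-digit2 q) c[q]≡0)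
  ...   | inj₂ c[q+1]≡0 = inj₂ (trans (cong c (sym (carry q))) (trans (c-digit0 (suc q)) c[q+1]≡0))

Subadditive : ℕ → Set
Subadditive n = ∀ i → S (i + n) ≤ S i + S n

subadditive-at : ∀ {m n} → Subadditive n → ∀ i → m ≤ i + n → S m ≤ S i + S n
subadditive-at sub i m≤i+n = ≤-trans (S-mono m≤i+n) (sub i)

subadditive-0 : Subadditive 0
subadditive-0 i = ≤-reflexive (trans (cong S (+-identityʳ i)) (sym (+-identityʳ (S i))))

subadditive-1 : Subadditive 1
subadditive-1 i = ≤-trans (≤-reflexive (S-split i 1))
  (+-monoʳ-≤ (S i) (≤-trans (≤-reflexive (+-identityʳ (c i))) (c≤1 i)))

sum-digits : ∀ a b r s → (3 * a + r) + (3 * b + s) ≡ 3 * (a + b) + (r + s)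
sum-digits = solve-∀

carry-3 : ∀ x t → 3 * x + (3 + t) ≡ 3 * suc x + t
carry-3 = solve-∀

module SubadditivityStep {b : ℕ} (sub-b : Subadditive b) (sub-b+1 : Subadditive (suc b)) where

  open ≤-Reasoning

  shift-left : ∀ a → S (suc (a + b)) ≤ S (suc a) + S b
  shift-left a = sub-b (suc a)

  shift-right : ∀ a → S (suc (a + b)) ≤ S a + S (suc b)
  shift-right a = subadditive-at sub-b+1 a (≤-reflexive (sym (+-suc a b)))

  -- The pair inequality needed when both arguments end in the digit 2;
  -- it holds because c(a) = 0 or c(a + 1) = 0.
  pair-bound : ∀ a → S (suc (a + b)) + S (suc (suc (a + b))) ≤ (S a + S (suc a)) + (S b + S (suc b))
  pair-bound a with no-adjacent-ones a
  ... | inj₁ c[a]≡0 = begin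
    S (suc (a + b)) + S (suc (suc (a + b)))
      ≤⟨ +-mono-≤ (shift-left a) (subadditive-at sub-b+1 (suc a) (≤-reflexive (cong suc (sym (+-suc a b))))) ⟩
    (S (suc a) + S b) + (S (suc a) + S (suc b))
      ≡⟨ interchange (S (suc a)) (S b) (S (suc a)) (S (suc b)) ⟩
    (S (suc a) + S (suc a)) + (S b + S (suc b))
      ≡⟨ cong (λ x → (x + S (suc a)) + (S b + S (suc b))) (S-flat a c[a]≡0) ⟩
    (S a + S (suc a)) + (S b + S (suc b)) ∎
  ... | inj₂ c[a+1]≡0 = begin
    S (suc (a + b)) + S (suc (suc (a + b)))
      ≤⟨ +-mono-≤ (shift-right a) (sub-b (suc (suc a))) ⟩
    (S a + S (suc b)) + (S (suc (suc a)) + S b)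
      ≡⟨ cong (λ x → (S a + S (suc b)) + (x + S b)) (S-flat (suc a) c[a+1]≡0) ⟩
    (S a + S (suc b)) + (S (suc a) + S b)
      ≡⟨ interchange (S a) (S (suc b)) (S (suc a)) (S b) ⟩
    (S a + S (suc a)) + (S (suc b) + S b)
      ≡⟨ cong ((S a + S (suc a)) +_) (+-comm (S (suc b)) (S b)) ⟩
    (S a + S (suc a)) + (S b + S (suc b)) ∎

  subadditive-3b+0 : Subadditive (3 * b + 0)
  subadditive-3b+0 i with ternary i
  ... | digit0 a = begin
    S (3 * a + 0 + (3 * b + 0))           ≡⟨ cong S (sum-digits a b 0 0) ⟩
    S (3 * (a + b) + 0)                   ≡⟨ S-digit0 (a + b) ⟩
    S (a + b) + S (a + b)                 ≤⟨ +-mono-≤ (sub-b a) (sub-b a) ⟩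
    (S a + S b) + (S a + S b)             ≡⟨ interchange (S a) (S b) (S a) (S b) ⟩
    (S a + S a) + (S b + S b)             ≡⟨ sym (cong₂ _+_ (S-digit0 a) (S-digit0 b)) ⟩
    S (3 * a + 0) + S (3 * b + 0)         ∎
  ... | digit1 a = begin
    S (3 * a + 1 + (3 * b + 0))           ≡⟨ cong S (sum-digits a b 1 0) ⟩
    S (3 * (a + b) + 1)                   ≡⟨ S-digit1 (a + b) ⟩
    S (a + b) + S (suc (a + b))           ≤⟨ +-mono-≤ (sub-b a) (shift-left a) ⟩
    (S a + S b) + (S (suc a) + S b)       ≡⟨ interchange (S a) (S b) (S (suc a)) (S b) ⟩
    (S a + S (suc a)) + (S b + S b)       ≡⟨ sym (cong₂ _+_ (S-digit1 a) (S-digit0 b)) ⟩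
    S (3 * a + 1) + S (3 * b + 0)         ∎
  ... | digit2 a = begin
    S (3 * a + 2 + (3 * b + 0))           ≡⟨ cong S (sum-digits a b 2 0) ⟩
    S (3 * (a + b) + 2)                   ≡⟨ S-digit2 (a + b) ⟩
    S (a + b) + S (suc (a + b))           ≤⟨ +-mono-≤ (sub-b a) (shift-left a) ⟩
    (S a + S b) + (S (suc a) + S b)       ≡⟨ interchange (S a) (S b) (S (suc a)) (S b) ⟩
    (S a + S (suc a)) + (S b + S b)       ≡⟨ sym (cong₂ _+_ (S-digit2 a) (S-digit0 b)) ⟩
    S (3 * a + 2) + S (3 * b + 0)         ∎

  subadditive-3b+1 : Subadditive (3 * b + 1)
  subadditive-3b+1 i with ternary i
  ... | digit0 a = begin
    S (3 * a + 0 + (3 * b + 1))           ≡⟨ cong S (sum-digits a b 0 1) ⟩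
    S (3 * (a + b) + 1)                   ≡⟨ S-digit1 (a + b) ⟩
    S (a + b) + S (suc (a + b))           ≤⟨ +-mono-≤ (sub-b a) (shift-right a) ⟩
    (S a + S b) + (S a + S (suc b))       ≡⟨ interchange (S a) (S b) (S a) (S (suc b)) ⟩
    (S a + S a) + (S b + S (suc b))       ≡⟨ sym (cong₂ _+_ (S-digit0 a) (S-digit1 b)) ⟩
    S (3 * a + 0) + S (3 * b + 1)         ∎
  ... | digit1 a = begin
    S (3 * a + 1 + (3 * b + 1))           ≡⟨ cong S (sum-digits a b 1 1) ⟩
    S (3 * (a + b) + 2)                   ≡⟨ S-digit2 (a + b) ⟩
    S (a + b) + S (suc (a + b))           ≤⟨ +-mono-≤ (sub-b a) (subadditive-at sub-b+1 (suc a) (s≤s (+-monoʳ-≤ a (n≤1+n b)))) ⟩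
    (S a + S b) + (S (suc a) + S (suc b)) ≡⟨ interchange (S a) (S b) (S (suc a)) (S (suc b)) ⟩
    (S a + S (suc a)) + (S b + S (suc b)) ≡⟨ sym (cong₂ _+_ (S-digit1 a) (S-digit1 b)) ⟩
    S (3 * a + 1) + S (3 * b + 1)         ∎
  ... | digit2 a = begin
    S (3 * a + 2 + (3 * b + 1))           ≡⟨ cong S (trans (sum-digits a b 2 1) (carry-3 (a + b) 0)) ⟩
    S (3 * suc (a + b) + 0)               ≡⟨ S-digit0 (suc (a + b)) ⟩
    S (suc (a + b)) + S (suc (a + b))     ≤⟨ +-mono-≤ (shift-right a) (shift-left a) ⟩
    (S a + S (suc b)) + (S (suc a) + S b) ≡⟨ interchange (S a) (S (suc b)) (S (suc a)) (S b) ⟩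
    (S a + S (suc a)) + (S (suc b) + S b) ≡⟨ cong₂ _+_ (sym (S-digit2 a)) (trans (+-comm (S (suc b)) (S b)) (sym (S-digit1 b))) ⟩
    S (3 * a + 2) + S (3 * b + 1)         ∎

  subadditive-3b+2 : Subadditive (3 * b + 2)
  subadditive-3b+2 i with ternary i
  ... | digit0 a = begin
    S (3 * a + 0 + (3 * b + 2))           ≡⟨ cong S (sum-digits a b 0 2) ⟩
    S (3 * (a + b) + 2)                   ≡⟨ S-digit2 (a + b) ⟩
    S (a + b) + S (suc (a + b))           ≤⟨ +-mono-≤ (sub-b a) (shift-right a) ⟩
    (S a + S b) + (S a + S (suc b))       ≡⟨ interchange (S a) (S b) (S a) (S (suc b)) ⟩
    (S a + S a) + (S b + S (suc b))       ≡⟨ sym (cong₂ _+_ (S-digit0 a) (S-digit2 b)) ⟩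
    S (3 * a + 0) + S (3 * b + 2)         ∎
  ... | digit1 a = begin
    S (3 * a + 1 + (3 * b + 2))           ≡⟨ cong S (trans (sum-digits a b 1 2) (carry-3 (a + b) 0)) ⟩
    S (3 * suc (a + b) + 0)               ≡⟨ S-digit0 (suc (a + b)) ⟩
    S (suc (a + b)) + S (suc (a + b))     ≤⟨ +-mono-≤ (shift-right a) (shift-left a) ⟩
    (S a + S (suc b)) + (S (suc a) + S b) ≡⟨ interchange (S a) (S (suc b)) (S (suc a)) (S b) ⟩
    (S a + S (suc a)) + (S (suc b) + S b) ≡⟨ cong₂ _+_ (sym (S-digit1 a)) (trans (+-comm (S (suc b)) (S b)) (sym (S-digit2 b))) ⟩
    S (3 * a + 1) + S (3 * b + 2)         ∎
  ... | digit2 a = begin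
    S (3 * a + 2 + (3 * b + 2))             ≡⟨ cong S (trans (sum-digits a b 2 2) (carry-3 (a + b) 1)) ⟩
    S (3 * suc (a + b) + 1)                 ≡⟨ S-digit1 (suc (a + b)) ⟩
    S (suc (a + b)) + S (suc (suc (a + b))) ≤⟨ pair-bound a ⟩
    (S a + S (suc a)) + (S b + S (suc b))   ≡⟨ sym (cong₂ _+_ (S-digit2 a) (S-digit2 b)) ⟩
    S (3 * a + 2) + S (3 * b + 2)           ∎

subadditive : ∀ n → Subadditive n
subadditive = <-rec Subadditive step
  where
  step : ∀ n → (∀ {m} → m < n → Subadditive m) → Subadditive n
  step n ih with ternary n
  ... | digit0 zero    = subadditive-0
  ... | digit1 zero    = subadditive-1
  ... | digit0 (suc b) = SubadditivityStep.subadditive-3b+0 (ih (<-trans (n<1+n (suc b)) (quotient<₀₁ b 0))) (ih (quotient<₀₁ b 0))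
  ... | digit1 (suc b) = SubadditivityStep.subadditive-3b+1 (ih (<-trans (n<1+n (suc b)) (quotient<₀₁ b 1))) (ih (quotient<₀₁ b 1))
  ... | digit2 b       = SubadditivityStep.subadditive-3b+2 (ih (<-trans (n<1+n b) (quotient<₂ b))) (ih (quotient<₂ b))

window-bound : ∀ i n → ones i n ≤ S n
window-bound i n = +-cancelˡ-≤ (S i) (ones i n) (S n)
  (subst (_≤ S i + S n) (S-split i n) (subadditive n i))

ones-slide : ∀ i n → ones i n ≤ suc (ones (suc i) n)
ones-slide i n = ≤-trans (ones-mono i (n≤1+n n)) (+-monoˡ-≤ (ones (suc i) n) (c≤1 i))

S-double-power : ∀ k → S (3 ^ k + 3 ^ k) ≡ S (3 ^ k)
S-double-power zero    = refl
S-double-power (suc k) = begin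
  S (3 * p + 3 * p)          ≡⟨ cong S (*-distribˡ-+ 3 p p) ⟨
  S (3 * (p + p))            ≡⟨ cong S (+-identityʳ (3 * (p + p))) ⟨
  S (3 * (p + p) + 0)        ≡⟨ S-digit0 (p + p) ⟩
  S (p + p) + S (p + p)      ≡⟨ cong₂ _+_ (S-double-power k) (S-double-power k) ⟩
  S p + S p                  ≡⟨ S-digit0 p ⟨
  S (3 * p + 0)              ≡⟨ cong S (+-identityʳ (3 * p)) ⟩
  S (3 * p)                  ∎
  where
  p = 3 ^ k
  open ≡-Reasoning

middle-third : ∀ k → ones (3 ^ k) (3 ^ k) ≡ 0
middle-third k = +-cancelˡ-≡ (S (3 ^ k)) (ones (3 ^ k) (3 ^ k)) 0
  (trans (sym (S-split (3 ^ k) (3 ^ k))) (trans (S-double-power k) (sym (+-identityʳ _))))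

n<3^n : ∀ n → n < 3 ^ n
n<3^n zero    = s≤s z≤n
n<3^n (suc n) = begin-strict
  suc n                      ≡⟨ +-comm 1 n ⟩
  n + 1                      <⟨ +-mono-<-≤ (n<3^n n) (m^n>0 3 n) ⟩
  3 ^ n + 3 ^ n              ≤⟨ +-monoʳ-≤ (3 ^ n) (m≤m+n (3 ^ n) _) ⟩
  3 * 3 ^ n                  ∎
  where open ≤-Reasoning

empty-window : ∀ n → ones (3 ^ n) n ≡ 0
empty-window n = n≤0⇒n≡0 (≤-trans (ones-mono (3 ^ n) (<⇒≤ (n<3^n n))) (≤-reflexive (middle-third n)))

intermediate-value : (f : ℕ → ℕ) → (∀ i → f i ≤ suc (f (suc i))) →
  ∀ K s j → j ≤ f s → f (s + K) ≤ j → ∃ λ i → f i ≡ j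
intermediate-value f step zero s j j≤fs fs≤j =
  s , ≤-antisym (subst (λ k → f k ≤ j) (+-identityʳ s) fs≤j) j≤fs
intermediate-value f step (suc K) s j j≤fs fend≤j with f s ≟ j
... | yes fs≡j = s , fs≡j
... | no  fs≢j = intermediate-value f step K (suc s) j
  (≤-pred (≤-trans (≤∧≢⇒< j≤fs (fs≢j ∘ sym)) (step s)))
  (subst (λ k → f k ≤ j) (+-suc s K) fend≤j)

every-count-occurs : ∀ n j → j ≤ S n → ∃ λ i → ones i n ≡ j
every-count-occurs n j j≤Sn = intermediate-value (λ i → ones i n) (λ i → ones-slide i n) (3 ^ n) 0 j j≤Sn
  (≤-trans (≤-reflexive (empty-window n)) z≤n)

count-ones-cons : ∀ x xs → proj₂ (parikh (x ∷ xs)) ≡ toℕ x + proj₂ (parikh xs)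
count-ones-cons 0F       xs = refl
count-ones-cons (1+F 0F) xs = refl

count-total : ∀ xs → proj₁ (parikh xs) + proj₂ (parikh xs) ≡ length xs
count-total []             = refl
count-total (0F ∷ xs)       = cong suc (count-total xs)
count-total (1+F 0F ∷ xs)   = trans (+-suc _ _) (cong suc (count-total xs))

count-ones-window : ∀ i n (g : ℕ → Fin 2) → (∀ j → g j ≡ cantor (i + j)) →
  proj₂ (parikh (applyUpTo g n)) ≡ ones i n
count-ones-window i zero    g g≗ = refl
count-ones-window i (suc n) g g≗ = begin
  proj₂ (parikh (applyUpTo g (suc n)))             ≡⟨ count-ones-cons (g 0) (applyUpTo (g ∘ suc) n) ⟩
  toℕ (g 0) + proj₂ (parikh (applyUpTo (g ∘ suc) n)) ≡⟨ cong₂ _+_ first rest ⟩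
  c i + ones (suc i) n                             ∎
  where
  open ≡-Reasoning
  first : toℕ (g 0) ≡ c i
  first = cong toℕ (trans (g≗ 0) (cong cantor (+-identityʳ i)))
  rest : proj₂ (parikh (applyUpTo (g ∘ suc) n)) ≡ ones (suc i) n
  rest = count-ones-window (suc i) n (g ∘ suc) (λ j → trans (g≗ (suc j)) (cong cantor (+-suc i j)))

parikh-factor : ∀ i n → parikh (factor i n) ≡ (n ∸ ones i n , ones i n)
parikh-factor i n = begin
  parikh (factor i n) ≡⟨ cong parikh (map-applyUpTo id letters n) ⟩
  parikh word         ≡⟨ cong₂ _,_ zeros≡ ones≡ ⟩
  (n ∸ ones i n , ones i n) ∎
  where
  open ≡-Reasoning
  letters : ℕ → Fin 2
  letters j = cantor (i + j)
  word : List (Fin 2)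
  word = applyUpTo letters n
  ones≡ : proj₂ (parikh word) ≡ ones i n
  ones≡ = count-ones-window i n letters (λ _ → refl)
  zeros≡ : proj₁ (parikh word) ≡ n ∸ ones i n
  zeros≡ = trans (sym (m+n∸n≡m (proj₁ (parikh word)) (proj₂ (parikh word))))
    (cong₂ _∸_ (trans (count-total word) (length-applyUpTo letters n)) ones≡)

abelian-complexity : ∀ n → AbelianComplexity n (suc (S n))
abelian-complexity n = vectors , length-applyUpTo vector (suc (S n)) , distinct ,
  λ v → mk⇔ (occurs v) (listed v)
  where
  vector : ℕ → ℕ × ℕ
  vector j = (n ∸ j , j)
  vectors : List (ℕ × ℕ)
  vectors = applyUpTo vector (suc (S n))
  distinct : Unique vectors
  distinct = applyUpTo⁺₁ vector (suc (S n)) (λ i<j _ eq → <⇒≢ i<j (cong proj₂ eq))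
  occurs : ∀ v → v ∈ vectors → IsFactorParikh n v
  occurs v v∈ with ∈-applyUpTo⁻ vector v∈
  ... | j , j<1+Sn , refl with every-count-occurs n j (≤-pred j<1+Sn)
  ...   | i , ones≡j = i , trans (parikh-factor i n) (cong vector ones≡j)
  listed : ∀ v → IsFactorParikh n v → v ∈ vectors
  listed v (i , parikh≡v) = subst (_∈ vectors) (trans (sym (parikh-factor i n)) parikh≡v)
    (∈-applyUpTo⁺ vector (s≤s (window-bound i n)))

Combination : (ℕ → ℕ) → Set
Combination f = Σ ℕ λ α → Σ ℕ λ β → ∀ n → f n ≡ α * S n + β * S (suc n)

combination-resp : ∀ {f g} → (∀ n → f n ≡ g n) → Combination g → Combination f
combination-resp f≗g (α , β , g≡) = α , β , λ n → trans (f≗g n) (g≡ n)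

combination-+ : ∀ {f g} → Combination f → Combination g → Combination (λ n → f n + g n)
combination-+ (α₁ , β₁ , f≡) (α₂ , β₂ , g≡) = α₁ + α₂ , β₁ + β₂ , λ n →
  trans (cong₂ _+_ (f≡ n) (g≡ n)) (collect α₁ β₁ α₂ β₂ (S n) (S (suc n)))
  where
  collect : ∀ α₁ β₁ α₂ β₂ x y → (α₁ * x + β₁ * y) + (α₂ * x + β₂ * y) ≡ (α₁ + α₂) * x + (β₁ + β₂) * y
  collect = solve-∀

unfold-power : ∀ p n q t → 3 * p * n + (3 * q + t) ≡ 3 * (p * n + q) + t
unfold-power = solve-∀

quotient-bound : ∀ {q t N} → 1 ≤ t → 3 * q + t ≤ 3 * N → suc q ≤ N
quotient-bound {q} {t} {N} 1≤t 3q+t≤3N = *-cancelˡ-< 3 q N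
  (≤-trans (≤-reflexive (+-comm 1 (3 * q))) (≤-trans (+-monoʳ-≤ (3 * q) 1≤t) 3q+t≤3N))

kernel-carry : ∀ e q t → (∀ m → S (3 * m + t) ≡ S m + S (suc m)) →
  Combination (λ n → S (3 ^ e * n + q)) → Combination (λ n → S (3 ^ e * n + suc q)) →
  Combination (λ n → S (3 ^ suc e * n + (3 * q + t)))
kernel-carry e q t S-digit below below+1 = combination-resp
  (λ n → trans (cong S (unfold-power (3 ^ e) n q t))
    (trans (S-digit (3 ^ e * n + q)) (cong (λ k → S (3 ^ e * n + q) + S k) (sym (+-suc (3 ^ e * n) q)))))
  (combination-+ below below+1)

-- Every sequence n ↦ S(3^e n + r) with r ≤ 3^e is a combination of
-- S(n) and S(n + 1): this is the finiteness behind 3-regularity.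
kernel-combination : ∀ e r → r ≤ 3 ^ e → Combination (λ n → S (3 ^ e * n + r))
kernel-combination zero zero _ = 1 , 0 , λ n →
  trans (cong S (trans (+-identityʳ (1 * n)) (*-identityˡ n))) (sym (trans (+-identityʳ (1 * S n)) (*-identityˡ (S n))))
kernel-combination zero (suc zero) _ = 0 , 1 , λ n →
  trans (cong S (trans (cong (_+ 1) (*-identityˡ n)) (+-comm n 1))) (sym (*-identityˡ (S (suc n))))
kernel-combination zero (suc (suc r)) (s≤s ())
kernel-combination (suc e) r r≤3^e+1 with ternary r
... | digit0 q = combination-resp
  (λ n → trans (cong S (unfold-power (3 ^ e) n q 0)) (S-digit0 (3 ^ e * n + q)))
  (combination-+ below below)
  where
  below : Combination (λ n → S (3 ^ e * n + q))
  below = kernel-combination e q (*-cancelˡ-≤ 3 (≤-trans (≤-reflexive (sym (+-identityʳ (3 * q)))) r≤3^e+1))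
... | digit1 q = kernel-carry e q 1 S-digit1 (kernel-combination e q (<⇒≤ q<3^e)) (kernel-combination e (suc q) q<3^e)
  where
  q<3^e : suc q ≤ 3 ^ e
  q<3^e = quotient-bound (s≤s z≤n) r≤3^e+1
... | digit2 q = kernel-carry e q 2 S-digit2 (kernel-combination e q (<⇒≤ q<3^e)) (kernel-combination e (suc q) q<3^e)
  where
  q<3^e : suc q ≤ 3 ^ e
  q<3^e = quotient-bound (s≤s z≤n) r≤3^e+1

-- The sequence m ↦ P(m + 1) whose 3-kernel is studied, where P(n) = S(n) + 1.
shifted-complexity : ℕ → ℤ
shifted-complexity m = ℤ.pos (suc (S (suc m)))

Affine : (ℕ → ℤ) → Set
Affine f = Σ ℤ λ α → Σ ℤ λ β → ∀ n → f n ≡ 1ℤ +ℤ (α *ℤ ℤ.pos (S n) +ℤ β *ℤ ℤ.pos (S (suc n)))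

cast-affine : ∀ α β x y → ℤ.pos (suc (α * x + β * y)) ≡ 1ℤ +ℤ (ℤ.pos α *ℤ ℤ.pos x +ℤ ℤ.pos β *ℤ ℤ.pos y)
cast-affine α β x y = trans (ℤₚ.pos-+ 1 (α * x + β * y))
  (cong (1ℤ +ℤ_) (trans (ℤₚ.pos-+ (α * x) (β * y)) (cong₂ _+ℤ_ (ℤₚ.pos-* α x) (ℤₚ.pos-* β y))))

kernel-affine : ∀ f → InKernel 3 shifted-complexity f → Affine f
kernel-affine f (e , r , r<3^e , f≡) with kernel-combination e (suc r) r<3^e
... | α , β , S≡ = ℤ.pos α , ℤ.pos β , λ n → begin
  f n                                         ≡⟨ f≡ n ⟩
  ℤ.pos (suc (S (suc (3 ^ e * n + r))))       ≡⟨ cong (λ k → ℤ.pos (suc (S k))) (sym (+-suc (3 ^ e * n) r)) ⟩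
  ℤ.pos (suc (S (3 ^ e * n + suc r)))         ≡⟨ cong (λ k → ℤ.pos (suc k)) (S≡ n) ⟩
  ℤ.pos (suc (α * S n + β * S (suc n)))       ≡⟨ cast-affine α β (S n) (S (suc n)) ⟩
  1ℤ +ℤ (ℤ.pos α *ℤ ℤ.pos (S n) +ℤ ℤ.pos β *ℤ ℤ.pos (S (suc n))) ∎
  where open ≡-Reasoning

generator₀ generator₁ generator₂ : ℕ → ℤ
generator₀ n = shifted-complexity (3 ^ 0 * n + 0)
generator₁ n = shifted-complexity (3 ^ 1 * n + 0)
generator₂ n = shifted-complexity (3 ^ 1 * n + 2)

generator₀-value : ∀ n → generator₀ n ≡ 1ℤ +ℤ ℤ.pos (S (suc n))
generator₀-value n = trans (cong (λ k → ℤ.pos (suc (S (suc k)))) (trans (+-identityʳ (1 * n)) (*-identityˡ n)))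
  (ℤₚ.pos-+ 1 (S (suc n)))

generator₁-value : ∀ n → generator₁ n ≡ 1ℤ +ℤ (ℤ.pos (S n) +ℤ ℤ.pos (S (suc n)))
generator₁-value n = begin
  ℤ.pos (suc (S (suc (3 * n + 0))))         ≡⟨ cong (λ k → ℤ.pos (suc (S k))) (sym (+-suc (3 * n) 0)) ⟩
  ℤ.pos (suc (S (3 * n + 1)))               ≡⟨ cong (λ k → ℤ.pos (suc k)) (S-digit1 n) ⟩
  ℤ.pos (suc (S n + S (suc n)))             ≡⟨ ℤₚ.pos-+ 1 (S n + S (suc n)) ⟩
  1ℤ +ℤ ℤ.pos (S n + S (suc n))             ≡⟨ cong (1ℤ +ℤ_) (ℤₚ.pos-+ (S n) (S (suc n))) ⟩
  1ℤ +ℤ (ℤ.pos (S n) +ℤ ℤ.pos (S (suc n))) ∎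
  where open ≡-Reasoning

generator₂-value : ∀ n → generator₂ n ≡ 1ℤ +ℤ (ℤ.pos (S (suc n)) +ℤ ℤ.pos (S (suc n)))
generator₂-value n = begin
  ℤ.pos (suc (S (suc (3 * n + 2))))               ≡⟨ cong (λ k → ℤ.pos (suc (S k))) (sym (carry n)) ⟩
  ℤ.pos (suc (S (3 * suc n + 0)))                 ≡⟨ cong (λ k → ℤ.pos (suc k)) (S-digit0 (suc n)) ⟩
  ℤ.pos (suc (S (suc n) + S (suc n)))             ≡⟨ ℤₚ.pos-+ 1 (S (suc n) + S (suc n)) ⟩
  1ℤ +ℤ ℤ.pos (S (suc n) + S (suc n))             ≡⟨ cong (1ℤ +ℤ_) (ℤₚ.pos-+ (S (suc n)) (S (suc n))) ⟩
  1ℤ +ℤ (ℤ.pos (S (suc n)) +ℤ ℤ.pos (S (suc n))) ∎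
  where open ≡-Reasoning

affine-decomposition : ∀ α β x y →
  1ℤ +ℤ (α *ℤ x +ℤ β *ℤ y) ≡
  (ℤ.pos 2 -ℤ α -ℤ β) *ℤ (1ℤ +ℤ y) +ℤ (α *ℤ (1ℤ +ℤ (x +ℤ y)) +ℤ ((β -ℤ 1ℤ) *ℤ (1ℤ +ℤ (y +ℤ y)) +ℤ 0ℤ))
affine-decomposition = ℤ-solve-∀

in-own-span : ∀ {f} → InKernel 3 shifted-complexity f → InSpan (InKernel 3 shifted-complexity) f
in-own-span {f} f∈kernel = f ∷ [] , f∈kernel All.∷ All.[] , 1ℤ ∷ [] , refl ,
  λ n → sym (trans (ℤₚ.+-identityʳ (1ℤ *ℤ f n)) (ℤₚ.*-identityˡ (f n)))

shifted-complexity-regular : Regular 3 shifted-complexity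
shifted-complexity-regular = generators ,
  in-own-span (0 , 0 , s≤s z≤n , λ _ → refl) All.∷
  in-own-span (1 , 0 , s≤s z≤n , λ _ → refl) All.∷
  in-own-span (1 , 2 , s≤s (s≤s (s≤s z≤n)) , λ _ → refl) All.∷ All.[] ,
  spanned
  where
  generators : List (ℕ → ℤ)
  generators = generator₀ ∷ generator₁ ∷ generator₂ ∷ []
  spanned : ∀ f → InKernel 3 shifted-complexity f → LinComb generators f
  spanned f f∈kernel with kernel-affine f f∈kernel
  ... | α , β , f≡ = a₀ ∷ α ∷ a₂ ∷ [] , refl , λ n → begin
    f n                                                   ≡⟨ f≡ n ⟩
    1ℤ +ℤ (α *ℤ X n +ℤ β *ℤ Y n)                          ≡⟨ affine-decomposition α β (X n) (Y n) ⟩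
    a₀ *ℤ (1ℤ +ℤ Y n) +ℤ (α *ℤ (1ℤ +ℤ (X n +ℤ Y n)) +ℤ (a₂ *ℤ (1ℤ +ℤ (Y n +ℤ Y n)) +ℤ 0ℤ))
      ≡⟨ sym (cong₂ (λ g₀ g₁₂ → a₀ *ℤ g₀ +ℤ g₁₂) (generator₀-value n)
               (cong₂ (λ g₁ g₂ → α *ℤ g₁ +ℤ (a₂ *ℤ g₂ +ℤ 0ℤ)) (generator₁-value n) (generator₂-value n))) ⟩
    a₀ *ℤ generator₀ n +ℤ (α *ℤ generator₁ n +ℤ (a₂ *ℤ generator₂ n +ℤ 0ℤ)) ∎
    where
    open ≡-Reasoning
    a₀ a₂ : ℤ
    a₀ = ℤ.pos 2 -ℤ α -ℤ β
    a₂ = β -ℤ 1ℤ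
    X Y : ℕ → ℤ
    X n = ℤ.pos (S n)
    Y n = ℤ.pos (S (suc n))

-- The recurrences of the theorem for P(n) = S(n) + 1; they hold for every n.
complexity-recurrences : ∀ n →
  (suc (S (3 * n)) + 1 ≡ 2 * suc (S n)) ×
  (suc (S (3 * n + 1)) + 1 ≡ suc (S n) + suc (S (n + 1))) ×
  (suc (S (3 * n + 2)) + 1 ≡ suc (S n) + suc (S (n + 1)))
complexity-recurrences n = digit0-case , digit12-case (3 * n + 1) (S-digit1 n) , digit12-case (3 * n + 2) (S-digit2 n)
  where
  open ≡-Reasoning
  double-succ : ∀ x → suc (x + x) + 1 ≡ 2 * suc x
  double-succ = solve-∀
  succ-sum : ∀ x y → suc (x + y) + 1 ≡ suc x + suc y
  succ-sum = solve-∀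
  digit0-case : suc (S (3 * n)) + 1 ≡ 2 * suc (S n)
  digit0-case = begin
    suc (S (3 * n)) + 1           ≡⟨ cong (λ k → suc (S k) + 1) (sym (+-identityʳ (3 * n))) ⟩
    suc (S (3 * n + 0)) + 1       ≡⟨ cong (λ k → suc k + 1) (S-digit0 n) ⟩
    suc (S n + S n) + 1           ≡⟨ double-succ (S n) ⟩
    2 * suc (S n)                 ∎
  digit12-case : ∀ m → S m ≡ S n + S (suc n) → suc (S m) + 1 ≡ suc (S n) + suc (S (n + 1))
  digit12-case m S≡ = begin
    suc (S m) + 1                 ≡⟨ cong (λ k → suc k + 1) S≡ ⟩
    suc (S n + S (suc n)) + 1     ≡⟨ succ-sum (S n) (S (suc n)) ⟩
    suc (S n) + suc (S (suc n))   ≡⟨ cong (λ k → suc (S n) + suc (S k)) (+-comm 1 n) ⟩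
    suc (S n) + suc (S (n + 1))   ∎

proposition2p4 : Σ (ℕ → ℕ) λ P →
    (∀ n → AbelianComplexity n (P n)) ×
    P 1 ≡ 2 × P 2 ≡ 2 ×
    (∀ n → 1 ≤ n →
      (P (3 * n) + 1 ≡ 2 * P n) ×
      (P (3 * n + 1) + 1 ≡ P n + P (n + 1)) ×
      (P (3 * n + 2) + 1 ≡ P n + P (n + 1))) ×
    Regular 3 (λ m → ℤ.pos (P (suc m)))
proposition2p4 =
  (λ n → suc (S n)) ,
  abelian-complexity ,
  refl , refl ,
  (λ n _ → complexity-recurrences n) ,
  shifted-complexity-regular
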